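{- For every partition $\lambda$, $\tau_{p_\lambda}=x^{\ell(\lambda)}(x-1)^{|\lambda|-\ell(\lambda)}$, where $p_\lambda$ is the power-sum symmetric function.
   Context: $p_n=\sum_i x_i^n$ and $p_\lambda=p_{\lambda_1}\cdots p_{\lambda_\ell}$ for $\lambda=(\lambda_1,\dots,\lambda_\ell)$; $\ell(\lambda)=\ell$, $|\lambda|=\sum\lambda_i$. For a graph $G$, $X_G=\sum_\kappa\prod_{v}x_{\kappa(v)}$ over proper colourings $\kappa:V(G)\to\mathbb{Z}_{>0}$. $P_\lambda$ is the disjoint union of paths with $\lambda_1,\dots,\lambda_\ell$ vertices; $\{X_{P_\lambda}\}$ is a basis of the algebra of symmetric functions over $\mathbb{Q}$. For $f=\sum_\lambda a_\lambda X_{P_\lambda}$, the tree polynomial is $\tau_f(x)=\sum_\lambda a_\lambda x^{\ell(\lambda)}$. -}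

module Defs where

open import Data.Nat as ℕ using (ℕ; zero; suc; _≥_; _≤_; _≡ᵇ_)
open import Data.Bool using (Bool; true; false; _∧_; _∨_; not; if_then_else_)
open import Data.List as List using (List; []; _∷_; length; map; concatMap; allFin; foldr)
open import Data.Nat.ListAction using (sum)
open import Data.Bool.ListAction using (all; any)
open import Data.List.Relation.Unary.All using (All)
open import Data.List.Relation.Unary.Linked using (Linked)
open import Data.Vec as Vec using (Vec; lookup)
open import Data.Fin as Fin using (Fin; toℕ)
open import Data.Product using (Σ; ∃-syntax; _×_; _,_; proj₁; proj₂)
open import Data.Rational as ℚ using (ℚ; 0ℚ; 1ℚ; _+_; _*_)
open import Relation.Binary.PropositionalEquality using (_≡_)

IsPartition : List ℕ → Set
IsPartition μ = All (λ k → 1 ≤ k) μ × Linked _≥_ μ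

size : List ℕ → ℕ
size = sum

ℓ : List ℕ → ℕ
ℓ = length

infixr 8 _^_
_^_ : ℚ → ℕ → ℚ
q ^ zero  = 1ℚ
q ^ suc k = q * (q ^ k)

sumℚ : List ℚ → ℚ
sumℚ = foldr _+_ 0ℚ

prodℚ : List ℚ → ℚ
prodℚ = foldr _*_ 1ℚ

-- Finite graphs on vertex set Fin n, and the chromatic symmetric function
-- X_G, represented by its evaluation at any point (x₁,…,x_N) ∈ ℚ^N
-- (i.e. setting x_i = 0 for i > N; colours are restricted to 1..N).

record Graph : Set where
  field
    nV  : ℕ
    adj : Fin nV → Fin nV → Bool
open Graph public

allVecs : (N k : ℕ) → List (Vec (Fin N) k)
allVecs N zero    = Vec.[] ∷ []
allVecs N (suc k) = concatMap (λ i → map (i Vec.∷_) (allVecs N k)) (allFin N)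

_≡ᶠ_ : {N : ℕ} → Fin N → Fin N → Bool
i ≡ᶠ j = toℕ i ≡ᵇ toℕ j

isProper : (G : Graph) {N : ℕ} → Vec (Fin N) (nV G) → Bool
isProper G κ =
  all (λ u → all (λ v → not (adj G u v) ∨ not (lookup κ u ≡ᶠ lookup κ v))
                 (allFin (nV G)))
      (allFin (nV G))

X : Graph → (N : ℕ) → (Fin N → ℚ) → ℚ
X G N x = sumℚ (map term (allVecs N (nV G)))
  where
  term : Vec (Fin N) (nV G) → ℚ
  term κ = if isProper G κ
             then prodℚ (map (λ v → x (lookup κ v)) (allFin (nV G)))
             else 0ℚ

-- The path forest P_μ: vertices 0,…,|μ|-1; the first path is
-- 0,…,μ₁-1, the second μ₁,…,μ₁+μ₂-1, etc.  Vertices w and w+1 are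
-- adjacent iff w+1 does not start a new path, i.e. w+1 is not a
-- partial sum μ₁+…+μⱼ.

cutsFrom : ℕ → List ℕ → List ℕ
cutsFrom s []      = []
cutsFrom s (a ∷ μ) = (s ℕ.+ a) ∷ cutsFrom (s ℕ.+ a) μ

isCut : List ℕ → ℕ → Bool
isCut μ w = any (λ c → c ≡ᵇ w) (cutsFrom 0 μ)

P : List ℕ → Graph
P μ = record
  { nV  = size μ
  ; adj = λ u v → ((suc (toℕ u) ≡ᵇ toℕ v) ∧ not (isCut μ (toℕ v)))
                ∨ ((suc (toℕ v) ≡ᵇ toℕ u) ∧ not (isCut μ (toℕ u)))
  }

sumFin : (N : ℕ) → (Fin N → ℚ) → ℚ
sumFin N f = sumℚ (map f (allFin N))

p : List ℕ → (N : ℕ) → (Fin N → ℚ) → ℚ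
p λs N x = prodℚ (map (λ k → sumFin N (λ j → x j ^ k)) λs)

-- A symmetric function is represented by its evaluations in every finite
-- number of variables.

SymFn : Set
SymFn = (N : ℕ) → (Fin N → ℚ) → ℚ

IsPathExpansion : SymFn → List (ℚ × List ℕ) → Set
IsPathExpansion f L =
  All (λ aμ → IsPartition (proj₂ aμ)) L ×
  ((N : ℕ) (x : Fin N → ℚ) →
     f N x ≡ sumℚ (map (λ aμ → proj₁ aμ * X (P (proj₂ aμ)) N x) L))

τ : List (ℚ × List ℕ) → ℚ → ℚ
τ L y = sumℚ (map (λ aμ → proj₁ aμ * (y ^ ℓ (proj₂ aμ))) L)

-- The X_{P_μ} are multiplicative, X_{P_μ} = Π X_{P_{μᵢ}}, and a path is coloured from one end:
-- if E_k(j) is the part of X_{P_{k+1}} whose first vertex has colour j, then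
-- E_{k+1}(j) = x_j (X_{P_{k+1}} − E_k(j)).  Multiplying by x_j^t and summing over j gives
-- Σ_j E_k(j) x_j^{t+1} = X_{P_{k+1}} p_{t+1} − Σ_j E_{k+1}(j) x_j^t, where the k = 0 sum is p_{t+1}
-- and the t = 0 sum is X_{P_{k+1}}; by induction on t every p_λ is a combination of X_{P_μ}'s.
-- In n + 1 variables all equal to c with n c = 1 every E_k(j) equals c, so there X_{P_μ} = (1 + c)^{ℓ(μ)}
-- and p_λ = (1 + c)^{ℓ(λ)} c^{|λ| − ℓ(λ)}.  Evaluating an expansion of p_λ at such a point shows that
-- τ(y) and y^{ℓ(λ)} (y − 1)^{|λ| − ℓ(λ)} agree at the infinitely many points y = 1 + 1/(k + 1),
-- hence everywhere, both being polynomials.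

module Submission where

open import Defs
open import Data.Nat using (ℕ; _∸_)
open import Data.List using (List)
open import Data.Product using (Σ; ∃-syntax; _×_)
open import Data.Rational using (ℚ; _*_; _-_; 1ℚ)
open import Relation.Binary.PropositionalEquality using (_≡_)

open import Level using (0ℓ)
open import Data.Nat as ℕ using (zero; suc; _<_; _≤_; _≡ᵇ_; z≤n; s≤s)
import Data.Nat.Properties as ℕ
import Data.Integer as ℤ
open import Data.Integer.Tactic.RingSolver using () renaming (solve-∀ to ℤ-solve-∀)
open import Data.Rational as ℚ using (0ℚ; _+_; -_; 1/_; ↧ₙ_)
import Data.Rational.Properties as ℚ
import Data.Rational.Unnormalised as ℚᵘ
import Data.Rational.Unnormalised.Properties as ℚᵘ
open import Data.Rational.Literals using (fromℤ)
open import Data.Bool using (Bool; true; false; T; not; _∧_; _∨_; if_then_else_)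
open import Data.Bool.Properties using (T-∧; T-∨; T-≡; ⇔→≡)
open import Data.Bool.ListAction using (all; any)
open import Data.Empty using (⊥-elim)
open import Data.Fin as Fin using (Fin; toℕ)
open import Data.List using ([]; _∷_; _++_; map; concatMap; merge; length; allFin; tabulate)
open import Data.List.Properties using (map-tabulate; map-cong; map-∘; map-++)
open import Data.List.Membership.Propositional.Properties using (∈-allFin)
open import Data.List.Relation.Unary.All as All using (All; []; _∷_)
open import Data.List.Relation.Unary.All.Properties using (all⁺; all⁻; ++⁺) renaming (map⁺ to All-map⁺)
open import Data.List.Relation.Unary.Linked using ([]; [-])
open import Data.List.Relation.Unary.Sorted.TotalOrder.Properties using (merge⁺)
open import Data.List.Relation.Binary.Permutation.Propositional using (_↭_; ↭-sym; ↭⇒↭ₛ)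
open import Data.List.Relation.Binary.Permutation.Propositional.Properties
  using (All-resp-↭; merge-↭) renaming (map⁺ to ↭-map⁺)
open import Data.List.Relation.Binary.Permutation.Setoid.Properties ℚ.≡-setoid using (foldr-commMonoid)
open import Data.Vec using (Vec; []; _∷_; lookup)
open import Data.Product using (_,_; proj₁; proj₂)
open import Data.Sum using (inj₁; inj₂)
open import Function using (_∘_; id; _⇔_; mk⇔; Equivalence)
open import Function.Definitions using (Injective)
open import Function.Properties.Equivalence using () renaming (sym to ⇔-sym; trans to ⇔-trans)
open import Relation.Binary.Bundles using (DecTotalOrder)
open import Relation.Binary.Properties.DecTotalOrder ℕ.≤-decTotalOrder using (≥-decTotalOrder)
open import Relation.Binary.PropositionalEquality using (_≢_; refl; sym; trans; cong; cong₂; module ≡-Reasoning)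
open import Relation.Nullary using (¬_)
open import Relation.Nullary.Decidable using (dec⇒maybe)
open import Tactic.RingSolver using (solve-∀)
open import Tactic.RingSolver.Core.AlmostCommutativeRing using (AlmostCommutativeRing; fromCommutativeRing)
open import Algebra.Bundles using (CommutativeRing)
open import Algebra.Properties.Group ℚ.+-0-group using (x∙y⁻¹≈ε⇒x≈y; x≈y⇒x∙y⁻¹≈ε)
open import Algebra.Properties.Semiring.Mult (CommutativeRing.semiring ℚ.+-*-commutativeRing)
  using (×-assoc-*) renaming (_×_ to _·_)
open import Algebra.Properties.Semiring.Sum (CommutativeRing.semiring ℚ.+-*-commutativeRing)
  using (sum; sum-cong-≗; ∑-distrib-+; *-distribˡ-sum; *-distribʳ-sum; sum-replicate)

open Equivalence using (to; from)

ℚ-ring : AlmostCommutativeRing 0ℓ 0ℓ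
ℚ-ring = fromCommutativeRing ℚ.+-*-commutativeRing (λ q → dec⇒maybe (0ℚ ℚ.≟ q))

sumℚ-tabulate : ∀ {n} (f : Fin n → ℚ) → sumℚ (tabulate f) ≡ sum f
sumℚ-tabulate {zero}  f = refl
sumℚ-tabulate {suc n} f = cong (f Fin.zero +_) (sumℚ-tabulate (f ∘ Fin.suc))

sumFin≡sum : ∀ n (f : Fin n → ℚ) → sumFin n f ≡ sum f
sumFin≡sum n f = trans (cong sumℚ (map-tabulate id f)) (sumℚ-tabulate f)

∑-neg : ∀ {n} (f : Fin n → ℚ) → sum (λ i → - f i) ≡ - sum f
∑-neg {zero}  f = refl
∑-neg {suc n} f = trans (cong (- f Fin.zero +_) (∑-neg (f ∘ Fin.suc)))
                        (sym (ℚ.neg-distrib-+ (f Fin.zero) _))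

∑-distrib-- : ∀ {n} (f g : Fin n → ℚ) → sum (λ i → f i - g i) ≡ sum f - sum g
∑-distrib-- f g = trans (∑-distrib-+ f (λ i → - g i)) (cong (sum f +_) (∑-neg g))

∑-omit : ∀ {n} (j : Fin n) (f : Fin n → ℚ) →
         sum (λ l → if not (j ≡ᶠ l) then f l else 0ℚ) ≡ sum f - f j
∑-omit {suc n} Fin.zero f = lemma (sum (f ∘ Fin.suc)) (f Fin.zero)
  where
  lemma : ∀ s a → 0ℚ + s ≡ (a + s) - a
  lemma = solve-∀ ℚ-ring
∑-omit {suc n} (Fin.suc j) f =
  trans (cong (f Fin.zero +_) (∑-omit j (f ∘ Fin.suc)))
        (lemma (f Fin.zero) (sum (f ∘ Fin.suc)) (f (Fin.suc j)))
  where
  lemma : ∀ a s b → a + (s - b) ≡ (a + s) - b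
  lemma = solve-∀ ℚ-ring

module _ {A : Set} where

  sumℚ-++ : ∀ (f : A → ℚ) xs ys → sumℚ (map f (xs ++ ys)) ≡ sumℚ (map f xs) + sumℚ (map f ys)
  sumℚ-++ f []       ys = sym (ℚ.+-identityˡ _)
  sumℚ-++ f (a ∷ xs) ys = trans (cong (f a +_) (sumℚ-++ f xs ys)) (sym (ℚ.+-assoc (f a) _ _))

  sumℚ-*ˡ : ∀ c (f : A → ℚ) xs → sumℚ (map (λ a → c * f a) xs) ≡ c * sumℚ (map f xs)
  sumℚ-*ˡ c f []       = sym (ℚ.*-zeroʳ c)
  sumℚ-*ˡ c f (a ∷ xs) = trans (cong (c * f a +_) (sumℚ-*ˡ c f xs)) (sym (ℚ.*-distribˡ-+ c (f a) _))

  sumℚ-zero : ∀ xs → sumℚ (map (λ (_ : A) → 0ℚ) xs) ≡ 0ℚ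
  sumℚ-zero []       = refl
  sumℚ-zero (_ ∷ xs) = trans (ℚ.+-identityˡ _) (sumℚ-zero xs)

sumℚ-concatMap : ∀ {A B : Set} (g : B → ℚ) (f : A → List B) xs →
  sumℚ (map g (concatMap f xs)) ≡ sumℚ (map (λ a → sumℚ (map g (f a))) xs)
sumℚ-concatMap g f []       = refl
sumℚ-concatMap g f (a ∷ xs) =
  trans (sumℚ-++ g (f a) (concatMap f xs)) (cong (sumℚ (map g (f a)) +_) (sumℚ-concatMap g f xs))

prodℚ-++ : ∀ xs ys → prodℚ (xs ++ ys) ≡ prodℚ xs * prodℚ ys
prodℚ-++ []       ys = sym (ℚ.*-identityˡ _)
prodℚ-++ (a ∷ xs) ys = trans (cong (a *_) (prodℚ-++ xs ys)) (sym (ℚ.*-assoc a _ _))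

prodℚ-↭ : ∀ {xs ys} → xs ↭ ys → prodℚ xs ≡ prodℚ ys
prodℚ-↭ xs↭ys = foldr-commMonoid ℚ.*-1-isCommutativeMonoid (↭⇒↭ₛ xs↭ys)

p*q≡0⇒q≡0 : ∀ {p q} → p ≢ 0ℚ → p * q ≡ 0ℚ → q ≡ 0ℚ
p*q≡0⇒q≡0 {p} {q} p≢0 pq≡0 = begin
  q                ≡⟨ ℚ.*-identityˡ q ⟨
  1ℚ * q           ≡⟨ cong (_* q) (ℚ.*-inverseˡ p) ⟨
  (1/ p) * p * q   ≡⟨ ℚ.*-assoc (1/ p) p q ⟩
  (1/ p) * (p * q) ≡⟨ cong ((1/ p) *_) pq≡0 ⟩
  (1/ p) * 0ℚ      ≡⟨ ℚ.*-zeroʳ (1/ p) ⟩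
  0ℚ               ∎
  where
  open ≡-Reasoning
  instance _ = ℚ.≢-nonZero p≢0

-- Polynomial functions

Poly : Set
Poly = List ℚ

eval : Poly → ℚ → ℚ
eval []       y = 0ℚ
eval (c ∷ cs) y = c + y * eval cs y

IsPolynomial : (ℚ → ℚ) → Set
IsPolynomial f = ∃[ cs ] (∀ y → eval cs y ≡ f y)

addPoly : Poly → Poly → Poly
addPoly []       ds       = ds
addPoly cs       []       = cs
addPoly (c ∷ cs) (d ∷ ds) = c + d ∷ addPoly cs ds

mulPoly : Poly → Poly → Poly
mulPoly []       ds = []
mulPoly (c ∷ cs) ds = addPoly (map (c *_) ds) (0ℚ ∷ mulPoly cs ds)

module _ (y : ℚ) where

  eval-addPoly : ∀ cs ds → eval (addPoly cs ds) y ≡ eval cs y + eval ds y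
  eval-addPoly []       ds       = sym (ℚ.+-identityˡ _)
  eval-addPoly (c ∷ cs) []       = sym (ℚ.+-identityʳ _)
  eval-addPoly (c ∷ cs) (d ∷ ds) =
    trans (cong (λ s → c + d + y * s) (eval-addPoly cs ds))
          (lemma c d (eval cs y) (eval ds y) y)
    where
    lemma : ∀ c d s t y → c + d + y * (s + t) ≡ (c + y * s) + (d + y * t)
    lemma = solve-∀ ℚ-ring

  eval-scale : ∀ c ds → eval (map (c *_) ds) y ≡ c * eval ds y
  eval-scale c []       = sym (ℚ.*-zeroʳ c)
  eval-scale c (d ∷ ds) =
    trans (cong (λ s → c * d + y * s) (eval-scale c ds)) (lemma c d (eval ds y) y)
    where
    lemma : ∀ c d s y → c * d + y * (c * s) ≡ c * (d + y * s)
    lemma = solve-∀ ℚ-ring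

  eval-mulPoly : ∀ cs ds → eval (mulPoly cs ds) y ≡ eval cs y * eval ds y
  eval-mulPoly []       ds = sym (ℚ.*-zeroˡ (eval ds y))
  eval-mulPoly (c ∷ cs) ds = begin
    eval (addPoly (map (c *_) ds) (0ℚ ∷ mulPoly cs ds)) y
      ≡⟨ eval-addPoly (map (c *_) ds) (0ℚ ∷ mulPoly cs ds) ⟩
    eval (map (c *_) ds) y + (0ℚ + y * eval (mulPoly cs ds) y)
      ≡⟨ cong₂ (λ s t → s + (0ℚ + y * t)) (eval-scale c ds) (eval-mulPoly cs ds) ⟩
    c * eval ds y + (0ℚ + y * (eval cs y * eval ds y))
      ≡⟨ lemma c (eval cs y) (eval ds y) y ⟩
    (c + y * eval cs y) * eval ds y ∎
    where
    open ≡-Reasoning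
    lemma : ∀ c s t y → c * t + (0ℚ + y * (s * t)) ≡ (c + y * s) * t
    lemma = solve-∀ ℚ-ring

polynomial-const : ∀ c → IsPolynomial (λ _ → c)
polynomial-const c = c ∷ [] , λ y → trans (cong (c +_) (ℚ.*-zeroʳ y)) (ℚ.+-identityʳ c)

polynomial-id : IsPolynomial (λ y → y)
polynomial-id = 0ℚ ∷ 1ℚ ∷ [] , lemma
  where
  lemma : ∀ y → 0ℚ + y * (1ℚ + y * 0ℚ) ≡ y
  lemma = solve-∀ ℚ-ring

polynomial-+ : ∀ {f g} → IsPolynomial f → IsPolynomial g → IsPolynomial (λ y → f y + g y)
polynomial-+ (cs , f≡) (ds , g≡) =
  addPoly cs ds , λ y → trans (eval-addPoly y cs ds) (cong₂ _+_ (f≡ y) (g≡ y))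

polynomial-* : ∀ {f g} → IsPolynomial f → IsPolynomial g → IsPolynomial (λ y → f y * g y)
polynomial-* (cs , f≡) (ds , g≡) =
  mulPoly cs ds , λ y → trans (eval-mulPoly y cs ds) (cong₂ _*_ (f≡ y) (g≡ y))

polynomial-^ : ∀ {f} → IsPolynomial f → ∀ n → IsPolynomial (λ y → f y ^ n)
polynomial-^ pf zero    = polynomial-const 1ℚ
polynomial-^ pf (suc n) = polynomial-* pf (polynomial-^ pf n)

polynomial-- : ∀ {f g} → IsPolynomial f → IsPolynomial g → IsPolynomial (λ y → f y - g y)
polynomial-- {f} {g} pf pg =
  let cs , h≡ = polynomial-+ pf (polynomial-* (polynomial-const (- 1ℚ)) pg)
  in cs , λ y → trans (h≡ y) (lemma (f y) (g y))
  where
  lemma : ∀ a b → a + (- 1ℚ) * b ≡ a - b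
  lemma = solve-∀ ℚ-ring

quotient : ℚ → Poly → Poly
quotient a []       = []
quotient a (d ∷ ds) = eval (d ∷ ds) a ∷ quotient a ds

length-quotient : ∀ a cs → length (quotient a cs) ≡ length cs
length-quotient a []       = refl
length-quotient a (d ∷ ds) = cong suc (length-quotient a ds)

eval-quotient : ∀ a y cs → y * eval cs y - a * eval cs a ≡ (y - a) * eval (quotient a cs) y
eval-quotient a y [] = lemma y a
  where
  lemma : ∀ y a → y * 0ℚ - a * 0ℚ ≡ (y - a) * 0ℚ
  lemma = solve-∀ ℚ-ring
eval-quotient a y (d ∷ ds) = begin
  y * (d + y * s) - a * (d + a * t)
    ≡⟨ lemma₁ y a d s t ⟩
  (y - a) * (d + a * t) + y * (y * s - a * t)
    ≡⟨ cong (λ u → (y - a) * (d + a * t) + y * u) (eval-quotient a y ds) ⟩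
  (y - a) * (d + a * t) + y * ((y - a) * q)
    ≡⟨ lemma₂ y a (d + a * t) q ⟩
  (y - a) * (d + a * t + y * q) ∎
  where
  open ≡-Reasoning
  s = eval ds y
  t = eval ds a
  q = eval (quotient a ds) y
  lemma₁ : ∀ y a d s t → y * (d + y * s) - a * (d + a * t) ≡ (y - a) * (d + a * t) + y * (y * s - a * t)
  lemma₁ = solve-∀ ℚ-ring
  lemma₂ : ∀ y a e q → (y - a) * e + y * ((y - a) * q) ≡ (y - a) * (e + y * q)
  lemma₂ = solve-∀ ℚ-ring

eval-factor : ∀ a y c cs → eval (c ∷ cs) y ≡ eval (c ∷ cs) a + (y - a) * eval (quotient a cs) y
eval-factor a y c cs =
  trans (lemma c y (eval cs y) a (eval cs a)) (cong (eval (c ∷ cs) a +_) (eval-quotient a y cs))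
  where
  lemma : ∀ c y s a t → c + y * s ≡ (c + a * t) + (y * s - a * t)
  lemma = solve-∀ ℚ-ring

module _ {r : ℕ → ℚ} (r-injective : Injective _≡_ _≡_ r) where

  eval-vanishes : ∀ cs → (∀ i → i < length cs → eval cs (r i) ≡ 0ℚ) → ∀ y → eval cs y ≡ 0ℚ
  eval-vanishes cs = go (length cs) cs refl
    where
    go : ∀ n cs → length cs ≡ n → (∀ i → i < n → eval cs (r i) ≡ 0ℚ) → ∀ y → eval cs y ≡ 0ℚ
    go zero    []       _      _    y = refl
    go (suc n) (c ∷ cs) |cs|≡n root y = begin
      eval (c ∷ cs) y
        ≡⟨ eval-factor a y c cs ⟩
      eval (c ∷ cs) a + (y - a) * eval (quotient a cs) y
        ≡⟨ cong₂ (λ u v → u + (y - a) * v) root-a (quotient-vanishes y) ⟩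
      0ℚ + (y - a) * 0ℚ
        ≡⟨ lemma (y - a) ⟩
      0ℚ ∎
      where
      open ≡-Reasoning
      a = r n
      root-a : eval (c ∷ cs) a ≡ 0ℚ
      root-a = root n (ℕ.n<1+n n)
      lemma : ∀ u → 0ℚ + u * 0ℚ ≡ 0ℚ
      lemma = solve-∀ ℚ-ring
      quotient-root : ∀ i → i < n → eval (quotient a cs) (r i) ≡ 0ℚ
      quotient-root i i<n = p*q≡0⇒q≡0 rᵢ-a≢0 (begin
        (r i - a) * q                   ≡⟨ ℚ.+-identityˡ _ ⟨
        0ℚ + (r i - a) * q              ≡⟨ cong (λ u → u + (r i - a) * q) root-a ⟨
        eval (c ∷ cs) a + (r i - a) * q ≡⟨ eval-factor a (r i) c cs ⟨
        eval (c ∷ cs) (r i)             ≡⟨ root i (ℕ.m<n⇒m<1+n i<n) ⟩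
        0ℚ                              ∎)
        where
        q = eval (quotient a cs) (r i)
        rᵢ-a≢0 : r i - a ≢ 0ℚ
        rᵢ-a≢0 eq = ℕ.<-irrefl (r-injective (x∙y⁻¹≈ε⇒x≈y (r i) a eq)) i<n
      quotient-vanishes : ∀ y → eval (quotient a cs) y ≡ 0ℚ
      quotient-vanishes =
        go n (quotient a cs) (trans (length-quotient a cs) (ℕ.suc-injective |cs|≡n)) quotient-root

  polynomial-ext : ∀ {f g} → IsPolynomial f → IsPolynomial g →
                   (∀ i → f (r i) ≡ g (r i)) → ∀ y → f y ≡ g y
  polynomial-ext {f} {g} pf pg f≡g y =
    let cs , h≡ = polynomial-- pf pg
        h-root i _ = trans (h≡ (r i)) (x≈y⇒x∙y⁻¹≈ε (f≡g i))
    in x∙y⁻¹≈ε⇒x≈y (f y) (g y) (trans (sym (h≡ y)) (eval-vanishes cs h-root y))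

-- Proper colourings of chains

-- Vertices w − 1 and w are joined exactly when f w, so that P μ is Chain (size μ) (not ∘ isCut μ).
Chain : ℕ → (ℕ → Bool) → Graph
Chain n f = record
  { nV  = n
  ; adj = λ u v → ((suc (toℕ u) ≡ᵇ toℕ v) ∧ f (toℕ v)) ∨ ((suc (toℕ v) ≡ᵇ toℕ u) ∧ f (toℕ u))
  }

T-injective : ∀ {b c} → T b ⇔ T c → b ≡ c
T-injective b⇔c = ⇔→≡ (⇔-trans (⇔-sym T-≡) (⇔-trans b⇔c T-≡))

T-nand : ∀ {b c} → T (not b ∨ not c) ⇔ (T b → ¬ T c)
T-nand {false}         = mk⇔ (λ _ ()) (λ _ → _)
T-nand {true}  {false} = mk⇔ (λ _ _ ()) (λ _ → _)
T-nand {true}  {true}  = mk⇔ (λ ()) (λ h → h _ _)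

T-all-allFin : ∀ {n} (p : Fin n → Bool) → T (all p (allFin n)) ⇔ (∀ i → T (p i))
T-all-allFin {n} p = mk⇔
  (λ h i → All.lookup (all⁺ p (allFin n) h) (∈-allFin i))
  (λ h → all⁻ p {allFin n} (All.tabulate (λ {i} _ → h i)))

module _ {N : ℕ} where

  -- Here e w concerns positions w and w + 1, one step earlier than the f of Chain.
  distinctAlong : ∀ {n} → (ℕ → Bool) → Vec (Fin N) n → Bool
  distinctAlong e []          = true
  distinctAlong e (i ∷ [])    = true
  distinctAlong e (i ∷ j ∷ κ) = (not (e 0) ∨ not (i ≡ᶠ j)) ∧ distinctAlong (e ∘ suc) (j ∷ κ)

  Separates : ∀ {n} → (ℕ → Bool) → Vec (Fin N) n → Set
  Separates f κ = ∀ u v → suc (toℕ u) ≡ toℕ v → T (f (toℕ v)) → ¬ T (lookup κ u ≡ᶠ lookup κ v)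

  ≡ᶠ-sym : ∀ {i j : Fin N} → T (i ≡ᶠ j) → T (j ≡ᶠ i)
  ≡ᶠ-sym {i} {j} i≡j = ℕ.≡⇒≡ᵇ _ _ (sym (ℕ.≡ᵇ⇒≡ (toℕ i) (toℕ j) i≡j))

  isProper⇔ : (G : Graph) (κ : Vec (Fin N) (nV G)) →
              T (isProper G κ) ⇔ (∀ u v → T (adj G u v) → ¬ T (lookup κ u ≡ᶠ lookup κ v))
  isProper⇔ G κ = ⇔-trans (T-all-allFin _) (mk⇔
    (λ proper u v → to T-nand (to (T-all-allFin _) (proper u) v))
    (λ distinct u → from (T-all-allFin _) (λ v → from T-nand (distinct u v))))

  module _ {n} (f : ℕ → Bool) (κ : Vec (Fin N) n) where

    AdjacentDistinct : Set
    AdjacentDistinct = ∀ u v → T (adj (Chain n f) u v) → ¬ T (lookup κ u ≡ᶠ lookup κ v)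

    adjacent⇒separates : AdjacentDistinct → Separates f κ
    adjacent⇒separates distinct u v u+1≡v fv =
      distinct u v (from T-∨ (inj₁ (from T-∧ (ℕ.≡⇒≡ᵇ _ _ u+1≡v , fv))))

    separates⇒adjacent : Separates f κ → AdjacentDistinct
    separates⇒adjacent sep u v uv with to T-∨ uv
    ... | inj₁ forward  = let u+1≡v , fv = to T-∧ forward in sep u v (ℕ.≡ᵇ⇒≡ _ _ u+1≡v) fv
    ... | inj₂ backward = let v+1≡u , fu = to T-∧ backward in
      λ same → sep v u (ℕ.≡ᵇ⇒≡ _ _ v+1≡u) fu (≡ᶠ-sym {lookup κ u} {lookup κ v} same)

  distinctAlong⇒separates : ∀ {n} (f : ℕ → Bool) (κ : Vec (Fin N) n) →
                            T (distinctAlong (f ∘ suc) κ) → Separates f κ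
  distinctAlong⇒separates f (i ∷ j ∷ κ) d Fin.zero (Fin.suc Fin.zero) refl f1 =
    to T-nand (proj₁ (to T-∧ d)) f1
  distinctAlong⇒separates f (i ∷ j ∷ κ) d (Fin.suc u) (Fin.suc v) u+1≡v =
    distinctAlong⇒separates (f ∘ suc) (j ∷ κ) (proj₂ (to T-∧ d)) u v (ℕ.suc-injective u+1≡v)

  separates⇒distinctAlong : ∀ {n} (f : ℕ → Bool) (κ : Vec (Fin N) n) →
                            Separates f κ → T (distinctAlong (f ∘ suc) κ)
  separates⇒distinctAlong f []          sep = _
  separates⇒distinctAlong f (i ∷ [])    sep = _
  separates⇒distinctAlong f (i ∷ j ∷ κ) sep = from T-∧
    ( from T-nand (sep Fin.zero (Fin.suc Fin.zero) refl)
    , separates⇒distinctAlong (f ∘ suc) (j ∷ κ)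
        (λ u v u+1≡v → sep (Fin.suc u) (Fin.suc v) (cong suc u+1≡v)) )

  isProper-Chain : ∀ {n} (f : ℕ → Bool) (κ : Vec (Fin N) n) →
                   isProper (Chain n f) κ ≡ distinctAlong (f ∘ suc) κ
  isProper-Chain f κ = T-injective (⇔-trans (isProper⇔ (Chain _ f) κ) (mk⇔
    (separates⇒distinctAlong f κ ∘ adjacent⇒separates f κ)
    (separates⇒adjacent f κ ∘ distinctAlong⇒separates f κ)))

-- Evaluating X on path forests

≡ᵇ-+ : ∀ s m n → (s ℕ.+ m ≡ᵇ s ℕ.+ n) ≡ (m ≡ᵇ n)
≡ᵇ-+ zero    m n = refl
≡ᵇ-+ (suc s) m n = ≡ᵇ-+ s m n

≡ᵇ-refl : ∀ n → (n ≡ᵇ n) ≡ true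
≡ᵇ-refl zero    = refl
≡ᵇ-refl (suc n) = ≡ᵇ-refl n

≢⇒≡ᵇ≡false : ∀ m n → m ≢ n → (m ≡ᵇ n) ≡ false
≢⇒≡ᵇ≡false zero    zero    m≢n = ⊥-elim (m≢n refl)
≢⇒≡ᵇ≡false zero    (suc n) _   = refl
≢⇒≡ᵇ≡false (suc m) zero    _   = refl
≢⇒≡ᵇ≡false (suc m) (suc n) m≢n = ≢⇒≡ᵇ≡false m n (m≢n ∘ cong suc)

cutsFrom-above : ∀ s ν t → t < s → any (λ c → c ≡ᵇ t) (cutsFrom s ν) ≡ false
cutsFrom-above s []      t t<s = refl
cutsFrom-above s (a ∷ ν) t t<s
  rewrite ≢⇒≡ᵇ≡false _ _ (ℕ.>⇒≢ (ℕ.<-≤-trans t<s (ℕ.m≤m+n s a)))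
  = cutsFrom-above (s ℕ.+ a) ν t (ℕ.<-≤-trans t<s (ℕ.m≤m+n s a))

cutsFrom-shift : ∀ s r ν t →
                 any (λ c → c ≡ᵇ s ℕ.+ t) (cutsFrom (s ℕ.+ r) ν) ≡ any (λ c → c ≡ᵇ t) (cutsFrom r ν)
cutsFrom-shift s r []      t = refl
cutsFrom-shift s r (a ∷ ν) t
  rewrite ℕ.+-assoc s r a | ≡ᵇ-+ s (r ℕ.+ a) t | cutsFrom-shift s (r ℕ.+ a) ν t = refl

forestEdges : List ℕ → ℕ → Bool
forestEdges μ w = not (isCut μ (suc w))

forestEdges-inner : ∀ k μ w → w < k → forestEdges (suc k ∷ μ) w ≡ true
forestEdges-inner k μ w w<k
  rewrite ≢⇒≡ᵇ≡false _ _ (ℕ.>⇒≢ (s≤s w<k)) | cutsFrom-above (suc k) μ (suc w) (s≤s w<k) = refl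

forestEdges-end : ∀ k μ → forestEdges (suc k ∷ μ) k ≡ false
forestEdges-end k μ rewrite ≡ᵇ-refl k = refl

forestEdges-shift : ∀ k μ w → forestEdges (suc k ∷ μ) (suc k ℕ.+ w) ≡ forestEdges μ w
forestEdges-shift k μ w = cong not (cong₂ _∨_ first-not-cut later-cuts)
  where
  first-not-cut : (suc k ≡ᵇ suc (suc k ℕ.+ w)) ≡ false
  first-not-cut = ≢⇒≡ᵇ≡false _ _ (ℕ.<⇒≢ (s≤s (s≤s (ℕ.m≤m+n k w))))
  later-cuts : any (λ c → c ≡ᵇ suc (suc k ℕ.+ w)) (cutsFrom (suc k) μ) ≡
               any (λ c → c ≡ᵇ suc w) (cutsFrom 0 μ)
  later-cuts = trans (cong₂ (λ t r → any (λ c → c ≡ᵇ t) (cutsFrom r μ))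
                            (sym (ℕ.+-suc (suc k) w)) (sym (ℕ.+-identityʳ (suc k))))
                     (cutsFrom-shift (suc k) 0 μ (suc w))

module Evaluation (N : ℕ) (x : Fin N → ℚ) where

  weight : ∀ {n} → Vec (Fin N) n → ℚ
  weight []      = 1ℚ
  weight (i ∷ κ) = x i * weight κ

  prodℚ-lookup : ∀ {n} (κ : Vec (Fin N) n) → prodℚ (map (λ v → x (lookup κ v)) (allFin n)) ≡ weight κ
  prodℚ-lookup κ = trans (cong prodℚ (map-tabulate id (λ v → x (lookup κ v)))) (prodℚ-tabulate κ)
    where
    prodℚ-tabulate : ∀ {n} (κ : Vec (Fin N) n) → prodℚ (tabulate (λ v → x (lookup κ v))) ≡ weight κ
    prodℚ-tabulate []      = refl
    prodℚ-tabulate (i ∷ κ) = cong (x i *_) (prodℚ-tabulate κ)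

  Σ-colourings : (n : ℕ) → (Vec (Fin N) n → ℚ) → ℚ
  Σ-colourings n g = sumℚ (map g (allVecs N n))

  Σ-colourings-cong : ∀ n {g h : Vec (Fin N) n → ℚ} → (∀ κ → g κ ≡ h κ) →
                      Σ-colourings n g ≡ Σ-colourings n h
  Σ-colourings-cong n g≡h = cong sumℚ (map-cong g≡h (allVecs N n))

  Σ-colourings-suc : ∀ n g → Σ-colourings (suc n) g ≡ sum (λ i → Σ-colourings n (λ κ → g (i ∷ κ)))
  Σ-colourings-suc n g = begin
    sumℚ (map g (concatMap (λ i → map (i ∷_) (allVecs N n)) (allFin N)))
      ≡⟨ sumℚ-concatMap g _ (allFin N) ⟩
    sumFin N (λ i → sumℚ (map g (map (i ∷_) (allVecs N n))))
      ≡⟨ cong sumℚ (map-cong (λ i → cong sumℚ (sym (map-∘ (allVecs N n)))) (allFin N)) ⟩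
    sumFin N (λ i → Σ-colourings n (λ κ → g (i ∷ κ)))
      ≡⟨ sumFin≡sum N _ ⟩
    sum (λ i → Σ-colourings n (λ κ → g (i ∷ κ))) ∎
    where open ≡-Reasoning

  Σ-colourings-if : ∀ n b (g : Vec (Fin N) n → ℚ) →
                    Σ-colourings n (λ κ → if b then g κ else 0ℚ) ≡ (if b then Σ-colourings n g else 0ℚ)
  Σ-colourings-if n true  g = refl
  Σ-colourings-if n false g = sumℚ-zero (allVecs N n)

  properWeight : ∀ {n} → (ℕ → Bool) → Vec (Fin N) n → ℚ
  properWeight e κ = if distinctAlong e κ then weight κ else 0ℚ

  chainSum : (ℕ → Bool) → ℕ → ℚ
  chainSum e n = Σ-colourings n (properWeight e)

  chainSumFrom : (ℕ → Bool) → ℕ → Fin N → ℚ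
  chainSumFrom e n i = Σ-colourings n (λ κ → properWeight e (i ∷ κ))

  X-Chain : ∀ n f → X (Chain n f) N x ≡ chainSum (f ∘ suc) n
  X-Chain n f = Σ-colourings-cong n (λ κ →
    cong₂ (λ b w → if b then w else 0ℚ) (isProper-Chain f κ) (prodℚ-lookup κ))

  distinctAlong-cong : ∀ {n e e'} → (∀ w → e w ≡ e' w) → (κ : Vec (Fin N) n) →
                       distinctAlong e κ ≡ distinctAlong e' κ
  distinctAlong-cong e≡e' []          = refl
  distinctAlong-cong e≡e' (i ∷ [])    = refl
  distinctAlong-cong e≡e' (i ∷ j ∷ κ) =
    cong₂ (λ b d → (not b ∨ not (i ≡ᶠ j)) ∧ d) (e≡e' 0) (distinctAlong-cong (e≡e' ∘ suc) (j ∷ κ))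

  chainSum-cong : ∀ {e e'} → (∀ w → e w ≡ e' w) → ∀ n → chainSum e n ≡ chainSum e' n
  chainSum-cong e≡e' n =
    Σ-colourings-cong n (λ κ → cong (λ b → if b then weight κ else 0ℚ) (distinctAlong-cong e≡e' κ))

  chainSum-zero : ∀ e → chainSum e 0 ≡ 1ℚ
  chainSum-zero e = ℚ.+-identityʳ 1ℚ

  chainSum-suc : ∀ e n → chainSum e (suc n) ≡ sum (chainSumFrom e n)
  chainSum-suc e n = Σ-colourings-suc n (properWeight e)

  chainSumFrom-zero : ∀ e i → chainSumFrom e 0 i ≡ x i
  chainSumFrom-zero e i = lemma (x i)
    where
    lemma : ∀ a → a * 1ℚ ℚ.+ 0ℚ ≡ a
    lemma = solve-∀ ℚ-ring

  properWeight-∷∷ : ∀ {n} e i l (κ : Vec (Fin N) n) →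
    properWeight e (i ∷ l ∷ κ) ≡
    x i * (if not (e 0) ∨ not (i ≡ᶠ l) then properWeight (e ∘ suc) (l ∷ κ) else 0ℚ)
  properWeight-∷∷ e i l κ with not (e 0) ∨ not (i ≡ᶠ l)
  ... | false = sym (ℚ.*-zeroʳ (x i))
  ... | true with distinctAlong (e ∘ suc) (l ∷ κ)
  ...   | true  = refl
  ...   | false = sym (ℚ.*-zeroʳ (x i))

  chainSumFrom-suc : ∀ e n i → chainSumFrom e (suc n) i ≡
    x i * sum (λ l → if not (e 0) ∨ not (i ≡ᶠ l) then chainSumFrom (e ∘ suc) n l else 0ℚ)
  chainSumFrom-suc e n i = begin
    chainSumFrom e (suc n) i
      ≡⟨ Σ-colourings-suc n _ ⟩
    sum (λ l → Σ-colourings n (λ κ → properWeight e (i ∷ l ∷ κ)))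
      ≡⟨ sum-cong-≗ first-edge ⟩
    sum (λ l → x i * (if not (e 0) ∨ not (i ≡ᶠ l) then chainSumFrom (e ∘ suc) n l else 0ℚ))
      ≡⟨ *-distribˡ-sum {N} (x i) _ ⟨
    x i * sum (λ l → if not (e 0) ∨ not (i ≡ᶠ l) then chainSumFrom (e ∘ suc) n l else 0ℚ) ∎
    where
    open ≡-Reasoning
    first-edge : ∀ l → Σ-colourings n (λ κ → properWeight e (i ∷ l ∷ κ)) ≡
                       x i * (if not (e 0) ∨ not (i ≡ᶠ l) then chainSumFrom (e ∘ suc) n l else 0ℚ)
    first-edge l = trans (Σ-colourings-cong n (properWeight-∷∷ e i l))
                  (trans (sumℚ-*ˡ (x i) _ (allVecs N n))
                         (cong (x i *_) (Σ-colourings-if n (not (e 0) ∨ not (i ≡ᶠ l)) _)))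

  -- pathSum n is X_{P_n}, and pathSumFrom k j is the E_k(j) of the opening sketch.
  pathSumFrom : ℕ → Fin N → ℚ
  pathSumFrom zero    j = x j
  pathSumFrom (suc k) j = x j * sum (λ l → if not (j ≡ᶠ l) then pathSumFrom k l else 0ℚ)

  pathSum : ℕ → ℚ
  pathSum zero    = 1ℚ
  pathSum (suc k) = sum (pathSumFrom k)

  chainSumFrom-cut : ∀ e → e 0 ≡ false → ∀ m j → chainSumFrom e m j ≡ x j * chainSum (e ∘ suc) m
  chainSumFrom-cut e e₀≡false zero j =
    trans (chainSumFrom-zero e j) (sym (trans (cong (x j *_) (chainSum-zero (e ∘ suc))) (ℚ.*-identityʳ (x j))))
  chainSumFrom-cut e e₀≡false (suc m) j = trans (chainSumFrom-suc e m j) (cong (x j *_) (begin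
    sum (λ l → if not (e 0) ∨ not (j ≡ᶠ l) then chainSumFrom (e ∘ suc) m l else 0ℚ)
      ≡⟨ sum-cong-≗ (λ l → cong (λ b → if not b ∨ not (j ≡ᶠ l) then chainSumFrom (e ∘ suc) m l else 0ℚ)
                                e₀≡false) ⟩
    sum (chainSumFrom (e ∘ suc) m)
      ≡⟨ chainSum-suc (e ∘ suc) m ⟨
    chainSum (e ∘ suc) (suc m) ∎))
    where open ≡-Reasoning

  chainSumFrom-path : ∀ k m e → (∀ w → w < k → e w ≡ true) → e k ≡ false → ∀ j →
                      chainSumFrom e (k ℕ.+ m) j ≡ pathSumFrom k j * chainSum (λ w → e (suc k ℕ.+ w)) m
  chainSumFrom-path zero    m e inner end j = chainSumFrom-cut e end m j
  chainSumFrom-path (suc k) m e inner end j = begin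
    chainSumFrom e (suc (k ℕ.+ m)) j
      ≡⟨ chainSumFrom-suc e (k ℕ.+ m) j ⟩
    x j * sum (λ l → if not (e 0) ∨ not (j ≡ᶠ l) then chainSumFrom (e ∘ suc) (k ℕ.+ m) l else 0ℚ)
      ≡⟨ cong (x j *_) (sum-cong-≗ peel) ⟩
    x j * sum (λ l → (if not (j ≡ᶠ l) then pathSumFrom k l else 0ℚ) * rest)
      ≡⟨ cong (x j *_) (*-distribʳ-sum {N} rest _) ⟨
    x j * (sum (λ l → if not (j ≡ᶠ l) then pathSumFrom k l else 0ℚ) * rest)
      ≡⟨ ℚ.*-assoc (x j) _ rest ⟨
    pathSumFrom (suc k) j * rest ∎
    where
    open ≡-Reasoning
    rest = chainSum (λ w → e (suc (suc k) ℕ.+ w)) m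
    if-*ʳ : ∀ b a → (if b then a * rest else 0ℚ) ≡ (if b then a else 0ℚ) * rest
    if-*ʳ true  a = refl
    if-*ʳ false a = sym (ℚ.*-zeroˡ rest)
    peel : ∀ l → (if not (e 0) ∨ not (j ≡ᶠ l) then chainSumFrom (e ∘ suc) (k ℕ.+ m) l else 0ℚ) ≡
                 (if not (j ≡ᶠ l) then pathSumFrom k l else 0ℚ) * rest
    peel l rewrite inner 0 (s≤s z≤n)
                 | chainSumFrom-path k m (e ∘ suc) (λ w w<k → inner (suc w) (s≤s w<k)) end l
      = if-*ʳ (not (j ≡ᶠ l)) (pathSumFrom k l)

  chainSum-forest : ∀ μ → All (1 ≤_) μ → chainSum (forestEdges μ) (size μ) ≡ prodℚ (map pathSum μ)
  chainSum-forest []              []            = chainSum-zero (forestEdges [])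
  chainSum-forest (suc k ∷ μ) (s≤s z≤n ∷ pos) = begin
    chainSum e (suc (k ℕ.+ size μ))
      ≡⟨ chainSum-suc e (k ℕ.+ size μ) ⟩
    sum (chainSumFrom e (k ℕ.+ size μ))
      ≡⟨ sum-cong-≗ (chainSumFrom-path k (size μ) e (forestEdges-inner k μ) (forestEdges-end k μ)) ⟩
    sum (λ j → pathSumFrom k j * chainSum (λ w → e (suc k ℕ.+ w)) (size μ))
      ≡⟨ *-distribʳ-sum {N} _ (pathSumFrom k) ⟨
    pathSum (suc k) * chainSum (λ w → e (suc k ℕ.+ w)) (size μ)
      ≡⟨ cong (pathSum (suc k) *_) (chainSum-cong (forestEdges-shift k μ) (size μ)) ⟩
    pathSum (suc k) * chainSum (forestEdges μ) (size μ)
      ≡⟨ cong (pathSum (suc k) *_) (chainSum-forest μ pos) ⟩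
    pathSum (suc k) * prodℚ (map pathSum μ) ∎
    where
    open ≡-Reasoning
    e = forestEdges (suc k ∷ μ)

  X-pathForest : ∀ μ → All (1 ≤_) μ → X (P μ) N x ≡ prodℚ (map pathSum μ)
  X-pathForest μ pos = trans (X-Chain (size μ) (λ w → not (isCut μ w))) (chainSum-forest μ pos)

  pathSumFrom-suc : ∀ k j → pathSumFrom (suc k) j ≡ x j * (pathSum (suc k) - pathSumFrom k j)
  pathSumFrom-suc k j = cong (x j *_) (∑-omit j (pathSumFrom k))

  weightedPowerSum : ℕ → ℕ → ℚ
  weightedPowerSum k t = sum (λ j → pathSumFrom k j * x j ^ t)

  weightedPowerSum-zero : ∀ k → weightedPowerSum k 0 ≡ pathSum (suc k)
  weightedPowerSum-zero k = sum-cong-≗ (λ j → ℚ.*-identityʳ (pathSumFrom k j))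

  weightedPowerSum-suc : ∀ k t →
    weightedPowerSum k (suc t) ≡ pathSum (suc k) * weightedPowerSum 0 t - weightedPowerSum (suc k) t
  weightedPowerSum-suc k t = begin
    weightedPowerSum k (suc t)                  ≡⟨ lemma (W * pₜ₊₁) (weightedPowerSum k (suc t)) ⟨
    W * pₜ₊₁ - (W * pₜ₊₁ - weightedPowerSum k (suc t)) ≡⟨ cong (λ u → W * pₜ₊₁ - u) next ⟨
    W * pₜ₊₁ - weightedPowerSum (suc k) t          ∎
    where
    open ≡-Reasoning
    W = pathSum (suc k)
    pₜ₊₁ = weightedPowerSum 0 t
    lemma : ∀ a b → a - (a - b) ≡ b
    lemma = solve-∀ ℚ-ring
    expand : ∀ a w e q → a * (w - e) * q ≡ w * (a * q) - e * (a * q)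
    expand = solve-∀ ℚ-ring
    next : weightedPowerSum (suc k) t ≡ W * pₜ₊₁ - weightedPowerSum k (suc t)
    next = begin
      sum (λ j → pathSumFrom (suc k) j * x j ^ t)
        ≡⟨ sum-cong-≗ (λ j → trans (cong (_* x j ^ t) (pathSumFrom-suc k j))
                                   (expand (x j) W (pathSumFrom k j) (x j ^ t))) ⟩
      sum (λ j → W * x j ^ suc t - pathSumFrom k j * x j ^ suc t)
        ≡⟨ ∑-distrib-- (λ j → W * x j ^ suc t) (λ j → pathSumFrom k j * x j ^ suc t) ⟩
      sum (λ j → W * x j ^ suc t) - weightedPowerSum k (suc t)
        ≡⟨ cong (_- weightedPowerSum k (suc t)) (*-distribˡ-sum {N} W _) ⟨
      W * pₜ₊₁ - weightedPowerSum k (suc t) ∎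

-- Expansions in the path basis

mergeParts : List ℕ → List ℕ → List ℕ
mergeParts = merge (DecTotalOrder._≤?_ ≥-decTotalOrder)

IsPartition-merge : ∀ {μ ν} → IsPartition μ → IsPartition ν → IsPartition (mergeParts μ ν)
IsPartition-merge {μ} {ν} (μ-pos , μ-sorted) (ν-pos , ν-sorted) =
  All-resp-↭ (↭-sym (merge-↭ _ μ ν)) (++⁺ μ-pos ν-pos) , merge⁺ ≥-decTotalOrder μ-sorted ν-sorted

prodℚ-map-merge : ∀ (g : ℕ → ℚ) μ ν → prodℚ (map g (mergeParts μ ν)) ≡ prodℚ (map g μ) * prodℚ (map g ν)
prodℚ-map-merge g μ ν = trans (prodℚ-↭ (↭-map⁺ g (merge-↭ _ μ ν)))
                              (trans (cong prodℚ (map-++ g μ ν)) (prodℚ-++ (map g μ) (map g ν)))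

X-merge : ∀ {μ ν} → IsPartition μ → IsPartition ν → ∀ N x →
          X (P (mergeParts μ ν)) N x ≡ X (P μ) N x * X (P ν) N x
X-merge {μ} {ν} pμ pν N x = begin
  X (P (mergeParts μ ν)) N x
    ≡⟨ X-pathForest (mergeParts μ ν) (proj₁ (IsPartition-merge pμ pν)) ⟩
  prodℚ (map pathSum (mergeParts μ ν))
    ≡⟨ prodℚ-map-merge pathSum μ ν ⟩
  prodℚ (map pathSum μ) * prodℚ (map pathSum ν)
    ≡⟨ cong₂ _*_ (X-pathForest μ (proj₁ pμ)) (X-pathForest ν (proj₁ pν)) ⟨
  X (P μ) N x * X (P ν) N x ∎
  where
  open ≡-Reasoning
  open Evaluation N x using (pathSum; X-pathForest)

Expansion : Set
Expansion = List (ℚ × List ℕ)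

⟦_⟧ : Expansion → SymFn
⟦ L ⟧ N x = sumℚ (map (λ aμ → proj₁ aμ * X (P (proj₂ aμ)) N x) L)

Partitions : Expansion → Set
Partitions = All (λ aμ → IsPartition (proj₂ aμ))

Expandable : SymFn → Set
Expandable f = ∃[ L ] IsPathExpansion f L

scale : ℚ → Expansion → Expansion
scale c = map (λ (a , μ) → c * a , μ)

⟦⟧-scale : ∀ c L N x → ⟦ scale c L ⟧ N x ≡ c * ⟦ L ⟧ N x
⟦⟧-scale c []            N x = sym (ℚ.*-zeroʳ c)
⟦⟧-scale c ((a , μ) ∷ L) N x =
  trans (cong ((c * a) * X (P μ) N x +_) (⟦⟧-scale c L N x)) (lemma c a (X (P μ) N x) (⟦ L ⟧ N x))
  where
  lemma : ∀ c a y s → c * a * y + c * s ≡ c * (a * y + s)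
  lemma = solve-∀ ℚ-ring

row : ℚ × List ℕ → Expansion → Expansion
row (a , μ) = map (λ (b , ν) → a * b , mergeParts μ ν)

_⊗_ : Expansion → Expansion → Expansion
L ⊗ M = concatMap (λ aμ → row aμ M) L

Partitions-row : ∀ a {μ} M → IsPartition μ → Partitions M → Partitions (row (a , μ) M)
Partitions-row a []      pμ []        = []
Partitions-row a (_ ∷ M) pμ (pν ∷ pM) = IsPartition-merge pμ pν ∷ Partitions-row a M pμ pM

Partitions-⊗ : ∀ L M → Partitions L → Partitions M → Partitions (L ⊗ M)
Partitions-⊗ []            M []        pM = []
Partitions-⊗ ((a , μ) ∷ L) M (pμ ∷ pL) pM = ++⁺ (Partitions-row a M pμ pM) (Partitions-⊗ L M pL pM)

⟦⟧-row : ∀ a {μ} M → IsPartition μ → Partitions M → ∀ N x →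
         ⟦ row (a , μ) M ⟧ N x ≡ (a * X (P μ) N x) * ⟦ M ⟧ N x
⟦⟧-row a {μ} []            pμ []        N x = sym (ℚ.*-zeroʳ (a * X (P μ) N x))
⟦⟧-row a {μ} ((b , ν) ∷ M) pμ (pν ∷ pM) N x =
  trans (cong₂ (λ y s → (a * b) * y + s) (X-merge pμ pν N x) (⟦⟧-row a M pμ pM N x))
        (lemma a b (X (P μ) N x) (X (P ν) N x) (⟦ M ⟧ N x))
  where
  lemma : ∀ a b y z s → (a * b) * (y * z) + (a * y) * s ≡ (a * y) * (b * z + s)
  lemma = solve-∀ ℚ-ring

⟦⟧-⊗ : ∀ L M → Partitions L → Partitions M → ∀ N x → ⟦ L ⊗ M ⟧ N x ≡ ⟦ L ⟧ N x * ⟦ M ⟧ N x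
⟦⟧-⊗ []            M []        pM N x = sym (ℚ.*-zeroˡ (⟦ M ⟧ N x))
⟦⟧-⊗ ((a , μ) ∷ L) M (pμ ∷ pL) pM N x = begin
  ⟦ row (a , μ) M ++ L ⊗ M ⟧ N x
    ≡⟨ sumℚ-++ _ (row (a , μ) M) (L ⊗ M) ⟩
  ⟦ row (a , μ) M ⟧ N x + ⟦ L ⊗ M ⟧ N x
    ≡⟨ cong₂ _+_ (⟦⟧-row a M pμ pM N x) (⟦⟧-⊗ L M pL pM N x) ⟩
  aXμ * ⟦ M ⟧ N x + ⟦ L ⟧ N x * ⟦ M ⟧ N x
    ≡⟨ ℚ.*-distribʳ-+ (⟦ M ⟧ N x) aXμ (⟦ L ⟧ N x) ⟨
  (aXμ + ⟦ L ⟧ N x) * ⟦ M ⟧ N x ∎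
  where
  open ≡-Reasoning
  aXμ = a * X (P μ) N x

module _ {f g : SymFn} where

  expandable-cong : (∀ N x → f N x ≡ g N x) → Expandable f → Expandable g
  expandable-cong f≡g (L , pL , f≡L) = L , pL , λ N x → trans (sym (f≡g N x)) (f≡L N x)

  expandable-+ : Expandable f → Expandable g → Expandable (λ N x → f N x + g N x)
  expandable-+ (L , pL , f≡L) (M , pM , g≡M) =
    L ++ M , ++⁺ pL pM , λ N x → trans (cong₂ _+_ (f≡L N x) (g≡M N x)) (sym (sumℚ-++ _ L M))

  expandable-* : Expandable f → Expandable g → Expandable (λ N x → f N x * g N x)
  expandable-* (L , pL , f≡L) (M , pM , g≡M) =
    L ⊗ M , Partitions-⊗ L M pL pM ,
    λ N x → trans (cong₂ _*_ (f≡L N x) (g≡M N x)) (sym (⟦⟧-⊗ L M pL pM N x))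

expandable-scale : ∀ {f} c → Expandable f → Expandable (λ N x → c * f N x)
expandable-scale c (L , pL , f≡L) =
  scale c L , All-map⁺ pL , λ N x → trans (cong (c *_) (f≡L N x)) (sym (⟦⟧-scale c L N x))

expandable-- : ∀ {f g} → Expandable f → Expandable g → Expandable (λ N x → f N x - g N x)
expandable-- {f} {g} ef eg =
  expandable-cong (λ N x → lemma (f N x) (g N x)) (expandable-+ ef (expandable-scale (- 1ℚ) eg))
  where
  lemma : ∀ a b → a + (- 1ℚ) * b ≡ a - b
  lemma = solve-∀ ℚ-ring

expandable-X : ∀ {μ} → IsPartition μ → Expandable (X (P μ))
expandable-X {μ} pμ = (1ℚ , μ) ∷ [] , pμ ∷ [] , λ N x → lemma (X (P μ) N x)
  where
  lemma : ∀ a → a ≡ 1ℚ * a + 0ℚ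
  lemma = solve-∀ ℚ-ring

expandable-pathSum : ∀ k → Expandable (λ N x → Evaluation.pathSum N x (suc k))
expandable-pathSum k = expandable-cong
  (λ N x → trans (Evaluation.X-pathForest N x (suc k ∷ []) (s≤s z≤n ∷ [])) (ℚ.*-identityʳ _))
  (expandable-X ((s≤s z≤n ∷ []) , [-]))

expandable-weightedPowerSum : ∀ t k → Expandable (λ N x → Evaluation.weightedPowerSum N x k t)
expandable-weightedPowerSum zero    k =
  expandable-cong (λ N x → sym (Evaluation.weightedPowerSum-zero N x k)) (expandable-pathSum k)
expandable-weightedPowerSum (suc t) k =
  expandable-cong (λ N x → sym (Evaluation.weightedPowerSum-suc N x k t))
    (expandable-- (expandable-* (expandable-pathSum k) (expandable-weightedPowerSum t 0))
                  (expandable-weightedPowerSum t (suc k)))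

expandable-p : ∀ λs → All (1 ≤_) λs → Expandable (p λs)
expandable-p []          []        =
  expandable-cong (λ N x → Evaluation.X-pathForest N x [] []) (expandable-X ([] , []))
expandable-p (suc t ∷ λs) (_ ∷ pos) =
  expandable-cong (λ N x → cong (_* p λs N x) (sym (sumFin≡sum N (λ j → x j ^ suc t))))
    (expandable-* (expandable-weightedPowerSum t 0) (expandable-p λs pos))

-- Evaluation at constant points

^-+ : ∀ q m n → q ^ (m ℕ.+ n) ≡ q ^ m * q ^ n
^-+ q zero    n = sym (ℚ.*-identityˡ (q ^ n))
^-+ q (suc m) n = trans (cong (q *_) (^-+ q m n)) (sym (ℚ.*-assoc q (q ^ m) (q ^ n)))

length≤size : ∀ μ → All (1 ≤_) μ → ℓ μ ≤ size μ
length≤size []          []        = z≤n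
length≤size (suc a ∷ μ) (_ ∷ pos) = s≤s (ℕ.≤-trans (length≤size μ pos) (ℕ.m≤n+m (size μ) a))

module ConstantPoint (n : ℕ) (c : ℚ) (n·c≡1 : n · c ≡ 1ℚ) where

  open Evaluation (suc n) (λ _ → c)

  sum-const : sum {suc n} (λ _ → c) ≡ 1ℚ + c
  sum-const = trans (sum-replicate (suc n) {c}) (trans (cong (c +_) n·c≡1) (ℚ.+-comm c 1ℚ))

  pathSumFrom-const : ∀ k j → pathSumFrom k j ≡ c
  pathSum-const : ∀ k → pathSum (suc k) ≡ 1ℚ + c

  pathSumFrom-const zero    j = refl
  pathSumFrom-const (suc k) j = begin
    pathSumFrom (suc k) j
      ≡⟨ pathSumFrom-suc k j ⟩
    c * (pathSum (suc k) - pathSumFrom k j)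
      ≡⟨ cong₂ (λ s e → c * (s - e)) (pathSum-const k) (pathSumFrom-const k j) ⟩
    c * ((1ℚ + c) - c)
      ≡⟨ lemma c ⟩
    c ∎
    where
    open ≡-Reasoning
    lemma : ∀ c → c * ((1ℚ + c) - c) ≡ c
    lemma = solve-∀ ℚ-ring

  pathSum-const k = trans (sum-cong-≗ (pathSumFrom-const k)) sum-const

  X-const : ∀ μ → All (1 ≤_) μ → X (P μ) (suc n) (λ _ → c) ≡ (1ℚ + c) ^ ℓ μ
  X-const μ pos = trans (X-pathForest μ pos) (prodℚ-pathSum μ pos)
    where
    prodℚ-pathSum : ∀ μ → All (1 ≤_) μ → prodℚ (map pathSum μ) ≡ (1ℚ + c) ^ ℓ μ
    prodℚ-pathSum []          []        = refl
    prodℚ-pathSum (suc k ∷ μ) (_ ∷ pos) = cong₂ _*_ (pathSum-const k) (prodℚ-pathSum μ pos)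

  p-const : ∀ λs → All (1 ≤_) λs →
            p λs (suc n) (λ _ → c) ≡ (1ℚ + c) ^ ℓ λs * c ^ (size λs ∸ ℓ λs)
  p-const []           []        = sym (ℚ.*-identityˡ 1ℚ)
  p-const (suc a ∷ λs) (_ ∷ pos) = begin
    sumFin (suc n) (λ _ → c ^ suc a) * p λs (suc n) (λ _ → c)
      ≡⟨ cong₂ _*_ power-sum (p-const λs pos) ⟩
    ((1ℚ + c) * c ^ a) * ((1ℚ + c) ^ ℓ λs * c ^ m)
      ≡⟨ lemma (1ℚ + c) (c ^ a) ((1ℚ + c) ^ ℓ λs) (c ^ m) ⟩
    (1ℚ + c) ^ suc (ℓ λs) * (c ^ a * c ^ m)
      ≡⟨ cong ((1ℚ + c) ^ suc (ℓ λs) *_) (^-+ c a m) ⟨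
    (1ℚ + c) ^ suc (ℓ λs) * c ^ (a ℕ.+ m)
      ≡⟨ cong (λ e → (1ℚ + c) ^ suc (ℓ λs) * c ^ e) (ℕ.+-∸-assoc a (length≤size λs pos)) ⟨
    (1ℚ + c) ^ suc (ℓ λs) * c ^ (a ℕ.+ size λs ∸ ℓ λs) ∎
    where
    open ≡-Reasoning
    m = size λs ∸ ℓ λs
    lemma : ∀ y u Y U → (y * u) * (Y * U) ≡ (y * Y) * (u * U)
    lemma = solve-∀ ℚ-ring
    power-sum : sumFin (suc n) (λ _ → c ^ suc a) ≡ (1ℚ + c) * c ^ a
    power-sum = trans (sumFin≡sum (suc n) (λ _ → c ^ suc a))
                      (trans (sym (*-distribʳ-sum {suc n} (c ^ a) (λ _ → c))) (cong (_* c ^ a) sum-const))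

  ⟦⟧-const : ∀ L → Partitions L → ⟦ L ⟧ (suc n) (λ _ → c) ≡ τ L (1ℚ + c)
  ⟦⟧-const []            []        = refl
  ⟦⟧-const ((a , μ) ∷ L) (pμ ∷ pL) = cong₂ _+_ (cong (a *_) (X-const μ (proj₁ pμ))) (⟦⟧-const L pL)

  τ-const : ∀ λs L → IsPartition λs → IsPathExpansion (p λs) L →
            τ L (1ℚ + c) ≡ (1ℚ + c) ^ ℓ λs * ((1ℚ + c) - 1ℚ) ^ (size λs ∸ ℓ λs)
  τ-const λs L (pos , _) (pL , p≡L) = begin
    τ L (1ℚ + c)                                ≡⟨ ⟦⟧-const L pL ⟨
    ⟦ L ⟧ (suc n) (λ _ → c)                     ≡⟨ p≡L (suc n) (λ _ → c) ⟨
    p λs (suc n) (λ _ → c)                      ≡⟨ p-const λs pos ⟩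
    (1ℚ + c) ^ ℓ λs * c ^ m                     ≡⟨ cong (λ u → (1ℚ + c) ^ ℓ λs * u ^ m) (lemma c) ⟩
    (1ℚ + c) ^ ℓ λs * ((1ℚ + c) - 1ℚ) ^ m       ∎
    where
    open ≡-Reasoning
    m = size λs ∸ ℓ λs
    lemma : ∀ c → c ≡ (1ℚ + c) - 1ℚ
    lemma = solve-∀ ℚ-ring

1+fromℤ : ∀ n → 1ℚ + fromℤ (ℤ.+ n) ≡ fromℤ (ℤ.+ suc n)
1+fromℤ n = ℚ.toℚᵘ-injective
  (ℚᵘ.≃-trans (ℚ.toℚᵘ-homo-+ 1ℚ (fromℤ (ℤ.+ n))) (ℚᵘ.*≡* (lemma (ℤ.+ n))))
  where
  lemma : ∀ m → (ℤ.+ 1 ℤ.* ℤ.+ 1 ℤ.+ m ℤ.* ℤ.+ 1) ℤ.* ℤ.+ 1 ≡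
                (ℤ.+ 1 ℤ.+ m) ℤ.* (ℤ.+ 1 ℤ.* ℤ.+ 1)
  lemma = ℤ-solve-∀

·1ℚ : ∀ n → n · 1ℚ ≡ fromℤ (ℤ.+ n)
·1ℚ zero    = refl
·1ℚ (suc n) = trans (cong (1ℚ +_) (·1ℚ n)) (1+fromℤ n)

point : ℕ → ℚ
point k = 1/ fromℤ (ℤ.+ suc k)

·point : ∀ k → suc k · point k ≡ 1ℚ
·point k = begin
  suc k · point k             ≡⟨ cong (suc k ·_) (ℚ.*-identityˡ (point k)) ⟨
  suc k · (1ℚ * point k)      ≡⟨ ×-assoc-* (suc k) 1ℚ (point k) ⟨
  (suc k · 1ℚ) * point k      ≡⟨ cong (_* point k) (·1ℚ (suc k)) ⟩
  fromℤ (ℤ.+ suc k) * point k ≡⟨ ℚ.*-inverseʳ (fromℤ (ℤ.+ suc k)) ⟩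
  1ℚ                          ∎
  where open ≡-Reasoning

-- ↧ₙ point k computes to suc k.
1+point-injective : Injective _≡_ _≡_ (λ k → 1ℚ + point k)
1+point-injective {i} {j} eq = ℕ.suc-injective (cong ↧ₙ_ (begin
  point i              ≡⟨ lemma (point i) ⟩
  (1ℚ + point i) - 1ℚ  ≡⟨ cong (_- 1ℚ) eq ⟩
  (1ℚ + point j) - 1ℚ  ≡⟨ lemma (point j) ⟨
  point j              ∎))
  where
  open ≡-Reasoning
  lemma : ∀ u → u ≡ (1ℚ + u) - 1ℚ
  lemma = solve-∀ ℚ-ring

polynomial-τ : ∀ L → IsPolynomial (τ L)
polynomial-τ []            = polynomial-const 0ℚ
polynomial-τ ((a , μ) ∷ L) =
  polynomial-+ (polynomial-* (polynomial-const a) (polynomial-^ polynomial-id (ℓ μ))) (polynomial-τ L)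

proposition4p2 : (λs : List ℕ) → IsPartition λs →
    (∃[ L ] IsPathExpansion (p λs) L) ×
    ((L : List (ℚ × List ℕ)) → IsPathExpansion (p λs) L →
      (y : ℚ) → τ L y ≡ (y ^ ℓ λs) * ((y - 1ℚ) ^ (size λs ∸ ℓ λs)))
proposition4p2 λs pλ = expandable-p λs (proj₁ pλ) , τ-unique
  where
  rhs-polynomial : IsPolynomial (λ y → (y ^ ℓ λs) * ((y - 1ℚ) ^ (size λs ∸ ℓ λs)))
  rhs-polynomial =
    polynomial-* (polynomial-^ polynomial-id (ℓ λs))
                 (polynomial-^ (polynomial-- polynomial-id (polynomial-const 1ℚ)) (size λs ∸ ℓ λs))
  τ-unique : (L : List (ℚ × List ℕ)) → IsPathExpansion (p λs) L →
             (y : ℚ) → τ L y ≡ (y ^ ℓ λs) * ((y - 1ℚ) ^ (size λs ∸ ℓ λs))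
  τ-unique L pe = polynomial-ext 1+point-injective (polynomial-τ L) rhs-polynomial
                    (λ k → ConstantPoint.τ-const (suc k) (point k) (·point k) λs L pλ pe)
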